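{- Let $k\ge1$ and $n\ge 1$ be integers. The number of $1$-marked $k_0$-Dyck paths with $n$ up-steps equals $s_{n,0,1}=\frac{k}{n}\binom{(k+1)(n-1)}{n-1}$, and these paths are in bijection with elevated $k_0$-Dyck paths with $n-1$ up-steps.
   Context: A $k_0$-Dyck path is a lattice path of up-steps $(1,k)$ and down-steps $(1,-1)$ starting at $(0,0)$, staying weakly above the $x$-axis and ending on the $x$-axis. A $1$-marked $k_0$-Dyck path is a $k_0$-Dyck path in which exactly one of the down-steps lying between the first and second up-steps (or after the first up-step, if there is only one up-step) is marked. $s_{n,0,1}$ is the total number of such down-steps over all $k_0$-Dyck paths with $n$ up-steps. An elevated $k_0$-Dyck path is a lattice path of up-steps $(1,k)$ and down-steps $(1,-1)$ that starts and ends on the line $y=j$ for some integer $0\le j<k$ and stays weakly above the $x$-axis. -}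

module Defs where

open import Data.Nat using (ℕ; zero; suc; _+_; _<_)
open import Data.List using (List; []; _∷_)
open import Data.Fin using (Fin)
open import Data.Product using (Σ; _×_; proj₁)
open import Data.Empty using (⊥)
open import Relation.Binary.PropositionalEquality using (_≡_)

-- Steps: U = up-step (1,k), D = down-step (1,-1).
data Step : Set where
  U D : Step

Walk : ℕ → ℕ → List Step → ℕ → Set
Walk k h [] e = h ≡ e
Walk k h (U ∷ p) e = Walk k (h + k) p e
Walk k zero (D ∷ p) e = ⊥
Walk k (suc h) (D ∷ p) e = Walk k h p e

countU : List Step → ℕ
countU [] = 0
countU (U ∷ p) = suc (countU p)
countU (D ∷ p) = countU p

Dyck : ℕ → ℕ → Set
Dyck k n = Σ (List Step) λ p → Walk k 0 p 0 × countU p ≡ n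

leadingD : List Step → ℕ
leadingD [] = 0
leadingD (U ∷ p) = 0
leadingD (D ∷ p) = suc (leadingD p)

firstRun : List Step → ℕ
firstRun [] = 0
firstRun (D ∷ p) = firstRun p
firstRun (U ∷ p) = leadingD p

-- 1-marked k_0-Dyck paths with n up-steps: a Dyck path together with a
-- choice of one of the down-steps between its first and second up-steps.
Marked : ℕ → ℕ → Set
Marked k n = Σ (Dyck k n) λ d → Fin (firstRun (proj₁ d))

Elevated : ℕ → ℕ → Set
Elevated k m = Σ ℕ λ j → j < k × Σ (List Step) λ p → Walk k j p j × countU p ≡ m

module Submission where

-- Fix k and put n = m + 1.  Write W(h,u,e) for the set of
-- step lists from height h to height e with u up-steps that stay weakly
-- above the x-axis.  Splitting such a walk by its first step gives a
-- recursion for its number w(h,u,e), and the same recursion builds an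
-- explicit bijection W(h,u,e) ≅ Fin w(h,u,e).
--  * A 1-marked path starts with an up-step to height k; marking the
--    (i+1)-st descent of the first run leaves a walk from height k-1-i to 0.
--    Hence Marked ≅ Fin N with N = Σ_{j<k} w(j,m,0).
--  * An elevated path is a walk in W(j,m,j) for some j < k, and for e ≤ k
--    one has w(h,u,e) = w(h,u,0) (a walk to 0 containing an up-step ends with
--    at least k descents).  Hence also Elevated ≅ Fin N, giving the bijection.
--  * Arithmetic: w(h,u,0) = C(N',u) - k C(N',u-1) with N' = h + (k+1)u; summing
--    over h < k (hockey stick) and using the absorption identity for binomial
--    coefficients yields (m+1) N = k C((k+1)m, m).

open import Defs
open import Data.Nat using (ℕ; zero; suc; _+_; _*_; _∸_; _≤_; _<_; z≤n; _≟_)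
open import Data.Nat.Properties
open import Data.Nat.Combinatorics using (_C_; nCk+nC[k+1]≡[n+1]C[k+1])
open import Data.Nat.Tactic.RingSolver using (solve-∀)
open import Data.Fin using (Fin; zero; suc)
open import Data.Fin.Properties using (+↔⊎; ¬Fin0)
open import Data.List using (List; []; _∷_)
open import Data.Product using (Σ; _×_; _,_; proj₁)
open import Data.Sum using (_⊎_; inj₁; inj₂)
open import Data.Sum.Function.Propositional using (_⊎-↔_)
open import Data.Empty using (⊥-elim)
open import Function.Bundles using (_↔_; mk↔ₛ′)
open import Function.Properties.Inverse using (↔-sym; ↔-trans)
open import Relation.Binary.PropositionalEquality
open import Relation.Nullary using (Dec; yes; no; ¬_)
open ≡-Reasoning

decCount : {P : Set} → Dec P → ℕ
decCount (yes _) = 1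
decCount (no _) = 0

decCount-yes : {P : Set} → P → (d : Dec P) → decCount d ≡ 1
decCount-yes p (yes _) = refl
decCount-yes p (no ¬p) = ⊥-elim (¬p p)

decCount-no : {P : Set} → ¬ P → (d : Dec P) → decCount d ≡ 0
decCount-no ¬p (yes p) = ⊥-elim (¬p p)
decCount-no ¬p (no _) = refl

dec↔Fin : {P : Set} → (∀ (x y : P) → x ≡ y) → (d : Dec P) → P ↔ Fin (decCount d)
dec↔Fin irr (yes p) = mk↔ₛ′ (λ _ → zero) (λ _ → p) (λ { zero → refl }) (irr p)
dec↔Fin irr (no ¬p) = mk↔ₛ′ (λ p → ⊥-elim (¬p p)) (λ ()) (λ ()) (λ p → ⊥-elim (¬p p))

⊎-Fin : {A B : Set} {m n : ℕ} → A ↔ Fin m → B ↔ Fin n → (A ⊎ B) ↔ Fin (m + n)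
⊎-Fin f g = ↔-trans (f ⊎-↔ g) (↔-sym +↔⊎)

sumBelow : ℕ → (ℕ → ℕ) → ℕ
sumBelow zero f = 0
sumBelow (suc H) f = f H + sumBelow H f

Below : ℕ → (ℕ → Set) → Set
Below H A = Σ ℕ λ j → j < H × A j

sumBelow-cong : ∀ H {f g : ℕ → ℕ} → (∀ j → j < H → f j ≡ g j) →
  sumBelow H f ≡ sumBelow H g
sumBelow-cong zero eq = refl
sumBelow-cong (suc H) eq =
  cong₂ _+_ (eq H (n<1+n H)) (sumBelow-cong H (λ j j<H → eq j (m<n⇒m<1+n j<H)))

below-suc : ∀ H (A : ℕ → Set) → Below (suc H) A ↔ (A H ⊎ Below H A)
below-suc H A = mk↔ₛ′ to from to∘from from∘to
  where
  to : Below (suc H) A → A H ⊎ Below H A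
  to (j , j<1+H , x) with j ≟ H
  ... | yes refl = inj₁ x
  ... | no j≢H = inj₂ (j , ≤∧≢⇒< (≤-pred j<1+H) j≢H , x)
  from : A H ⊎ Below H A → Below (suc H) A
  from (inj₁ x) = H , n<1+n H , x
  from (inj₂ (j , j<H , x)) = j , m<n⇒m<1+n j<H , x
  to∘from : ∀ y → to (from y) ≡ y
  to∘from (inj₁ x) with H ≟ H
  ... | yes refl = refl
  ... | no H≢H = ⊥-elim (H≢H refl)
  to∘from (inj₂ (j , j<H , x)) with j ≟ H
  ... | yes refl = ⊥-elim (<-irrefl refl j<H)
  ... | no _ = cong (λ j<H′ → inj₂ (j , j<H′ , x)) (<-irrelevant _ _)
  from∘to : ∀ x → from (to x) ≡ x
  from∘to (j , j<1+H , x) with j ≟ H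
  ... | yes refl = cong (λ lt → H , lt , x) (<-irrelevant _ _)
  ... | no _ = cong (λ lt → j , lt , x) (<-irrelevant _ _)

below-Fin : ∀ H {A : ℕ → Set} {f : ℕ → ℕ} → (∀ j → A j ↔ Fin (f j)) →
  Below H A ↔ Fin (sumBelow H f)
below-Fin zero en = mk↔ₛ′ (λ { (_ , () , _) }) (λ ()) (λ ()) (λ { (_ , () , _) })
below-Fin (suc H) en = ↔-trans (below-suc H _) (⊎-Fin (en H) (below-Fin H en))

binom : ℕ → ℕ → ℕ
binom n zero = 1
binom zero (suc r) = 0
binom (suc n) (suc r) = binom n r + binom n (suc r)

binom≡C : ∀ n r → binom n r ≡ n C r
binom≡C n zero = refl
binom≡C zero (suc r) = refl
binom≡C (suc n) (suc r) =
  trans (cong₂ _+_ (binom≡C n r) (binom≡C n (suc r))) (nCk+nC[k+1]≡[n+1]C[k+1] n r)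

binomPred : ℕ → ℕ → ℕ
binomPred N zero = 0
binomPred N (suc r) = binom N r

pascal : ∀ N r → binom (suc N) r ≡ binomPred N r + binom N r
pascal N zero = refl
pascal N (suc r) = refl

binom-1 : ∀ N → binom N 1 ≡ N
binom-1 zero = refl
binom-1 (suc N) = cong suc (binom-1 N)

absorption : ∀ N r → suc r * binom (suc N) (suc r) ≡ suc N * binom N r
absorption zero zero = refl
absorption zero (suc r) = *-zeroʳ (suc (suc r))
absorption (suc N) zero =
  trans (*-identityˡ (binom (suc (suc N)) 1))
    (trans (binom-1 (suc (suc N))) (sym (*-identityʳ (suc (suc N)))))
absorption (suc N) (suc r) = begin
    suc (suc r) * ((a + b) + d)
  ≡⟨ expand r a b d ⟩
    ((a + b) + suc r * (a + b)) + suc (suc r) * d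
  ≡⟨ cong₂ (λ x y → ((a + b) + x) + y) (absorption N r) (absorption N (suc r)) ⟩
    ((a + b) + suc N * a) + suc N * b
  ≡⟨ collect N a b ⟩
    suc (suc N) * (a + b)
  ∎
  where
  a b d : ℕ
  a = binom N r
  b = binom N (suc r)
  d = binom (suc N) (suc (suc r))
  expand : ∀ r a b d → suc (suc r) * ((a + b) + d) ≡ ((a + b) + suc r * (a + b)) + suc (suc r) * d
  expand = solve-∀
  collect : ∀ N a b → ((a + b) + suc N * a) + suc N * b ≡ suc (suc N) * (a + b)
  collect = solve-∀

absorption-shifted : ∀ r s → suc r * binom (s + r) (suc r) ≡ s * binom (s + r) r
absorption-shifted r s = +-cancelʳ-≡ (r * binom N r) _ _ (begin
    suc r * binom N (suc r) + r * binom N r  ≡⟨ upper ⟩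
    N * binom N r                            ≡⟨ *-distribʳ-+ (binom N r) s r ⟩
    s * binom N r + r * binom N r            ∎)
  where
  N : ℕ
  N = s + r
  upper : suc r * binom N (suc r) + r * binom N r ≡ N * binom N r
  upper = +-cancelˡ-≡ (binom N r) _ _
    (trans (regroup r (binom N r) (binom N (suc r))) (absorption N r))
    where
    regroup : ∀ r a b → a + (suc r * b + r * a) ≡ suc r * (a + b)
    regroup = solve-∀

binom-at-k : ∀ k v → binom (k + suc k * v) (suc v) ≡ k * binom (k + suc k * v) v
binom-at-k k v = *-cancelˡ-≡ _ _ (suc v) (trans scaled (regroup k v (binom N v)))
  where
  N : ℕ
  N = k + suc k * v
  split : ∀ k v → (k + k * v) + v ≡ k + suc k * v
  split = solve-∀
  regroup : ∀ k v B → (k + k * v) * B ≡ suc v * (k * B)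
  regroup = solve-∀
  scaled : suc v * binom N (suc v) ≡ (k + k * v) * binom N v
  scaled = subst (λ X → suc v * binom X (suc v) ≡ (k + k * v) * binom X v)
    (split k v) (absorption-shifted v (k + k * v))

binom-at-0 : ∀ k m → suc m * binom (suc k * m) (suc m) ≡ k * m * binom (suc k * m) m
binom-at-0 k m = subst (λ X → suc m * binom X (suc m) ≡ k * m * binom X m)
  (+-comm (k * m) m) (absorption-shifted m (k * m))

module Paths (k : ℕ) where

  Walks : ℕ → ℕ → ℕ → Set
  Walks h u e = Σ (List Step) λ p → Walk k h p e × countU p ≡ u

  walks-≡ : ∀ {h u e p} {w : Walk k h p e} {c c′ : countU p ≡ u} →
    _≡_ {A = Walks h u e} (p , w , c) (p , w , c′)
  walks-≡ {p = p} {w} = cong (λ c → p , w , c) (≡-irrelevant _ _)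

  walks-00 : ∀ e → Walks 0 0 e ↔ (0 ≡ e)
  walks-00 e = mk↔ₛ′ to (λ w → [] , w , refl) (λ _ → refl) from∘to
    where
    to : Walks 0 0 e → 0 ≡ e
    to ([] , w , _) = w
    to (U ∷ p , _ , ())
    to (D ∷ p , () , _)
    from∘to : ∀ x → ([] , to x , refl) ≡ x
    from∘to ([] , w , c) = walks-≡
    from∘to (U ∷ p , _ , ())
    from∘to (D ∷ p , () , _)

  walks-s0 : ∀ h e → Walks (suc h) 0 e ↔ (suc h ≡ e ⊎ Walks h 0 e)
  walks-s0 h e = mk↔ₛ′ to from to∘from from∘to
    where
    to : Walks (suc h) 0 e → suc h ≡ e ⊎ Walks h 0 e
    to ([] , w , _) = inj₁ w
    to (U ∷ p , _ , ())
    to (D ∷ p , w , c) = inj₂ (p , w , c)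
    from : suc h ≡ e ⊎ Walks h 0 e → Walks (suc h) 0 e
    from (inj₁ w) = [] , w , refl
    from (inj₂ (p , w , c)) = D ∷ p , w , c
    to∘from : ∀ y → to (from y) ≡ y
    to∘from (inj₁ _) = refl
    to∘from (inj₂ _) = refl
    from∘to : ∀ x → from (to x) ≡ x
    from∘to ([] , w , c) = walks-≡
    from∘to (U ∷ p , _ , ())
    from∘to (D ∷ p , w , c) = refl

  walks-0s : ∀ u e → Walks 0 (suc u) e ↔ Walks k u e
  walks-0s u e = mk↔ₛ′ to from (λ _ → walks-≡) from∘to
    where
    to : Walks 0 (suc u) e → Walks k u e
    to ([] , _ , ())
    to (U ∷ p , w , c) = p , w , suc-injective c
    to (D ∷ p , () , _)
    from : Walks k u e → Walks 0 (suc u) e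
    from (p , w , c) = U ∷ p , w , cong suc c
    from∘to : ∀ x → from (to x) ≡ x
    from∘to ([] , _ , ())
    from∘to (U ∷ p , w , c) = walks-≡
    from∘to (D ∷ p , () , _)

  walks-ss : ∀ h u e →
    Walks (suc h) (suc u) e ↔ (Walks (suc h + k) u e ⊎ Walks h (suc u) e)
  walks-ss h u e = mk↔ₛ′ to from to∘from from∘to
    where
    to : Walks (suc h) (suc u) e → Walks (suc h + k) u e ⊎ Walks h (suc u) e
    to ([] , _ , ())
    to (U ∷ p , w , c) = inj₁ (p , w , suc-injective c)
    to (D ∷ p , w , c) = inj₂ (p , w , c)
    from : Walks (suc h + k) u e ⊎ Walks h (suc u) e → Walks (suc h) (suc u) e
    from (inj₁ (p , w , c)) = U ∷ p , w , cong suc c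
    from (inj₂ (p , w , c)) = D ∷ p , w , c
    to∘from : ∀ y → to (from y) ≡ y
    to∘from (inj₁ _) = cong inj₁ walks-≡
    to∘from (inj₂ _) = refl
    from∘to : ∀ x → from (to x) ≡ x
    from∘to ([] , _ , ())
    from∘to (U ∷ p , w , c) = walks-≡
    from∘to (D ∷ p , w , c) = refl

  nWalks : ℕ → ℕ → ℕ → ℕ
  nWalks zero zero e = decCount (0 ≟ e)
  nWalks (suc h) zero e = decCount (suc h ≟ e) + nWalks h zero e
  nWalks zero (suc u) e = nWalks k u e
  nWalks (suc h) (suc u) e = nWalks (suc h + k) u e + nWalks h (suc u) e

  walks-enum : ∀ h u e → Walks h u e ↔ Fin (nWalks h u e)
  walks-enum zero zero e = ↔-trans (walks-00 e) (dec↔Fin ≡-irrelevant (0 ≟ e))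
  walks-enum (suc h) zero e = ↔-trans (walks-s0 h e)
    (⊎-Fin (dec↔Fin ≡-irrelevant (suc h ≟ e)) (walks-enum h zero e))
  walks-enum zero (suc u) e = ↔-trans (walks-0s u e) (walks-enum k u e)
  walks-enum (suc h) (suc u) e = ↔-trans (walks-ss h u e)
    (⊎-Fin (walks-enum (suc h + k) u e) (walks-enum h (suc u) e))

  nWalks-noUp-< : ∀ h e → h < e → nWalks h 0 e ≡ 0
  nWalks-noUp-< zero e h<e = decCount-no (<⇒≢ h<e) (0 ≟ e)
  nWalks-noUp-< (suc h) e h<e =
    cong₂ _+_ (decCount-no (<⇒≢ h<e) (suc h ≟ e)) (nWalks-noUp-< h e (<⇒≤ h<e))

  nWalks-noUp : ∀ h e → e ≤ h → nWalks h 0 e ≡ 1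
  nWalks-noUp zero .zero z≤n = decCount-yes refl (0 ≟ 0)
  nWalks-noUp (suc h) e e≤1+h with m≤n⇒m<n∨m≡n e≤1+h
  ... | inj₁ e<1+h = cong₂ _+_ (decCount-no (≢-sym (<⇒≢ e<1+h)) (suc h ≟ e))
                               (nWalks-noUp h e (≤-pred e<1+h))
  ... | inj₂ refl = cong₂ _+_ (decCount-yes refl (suc h ≟ suc h))
                              (nWalks-noUp-< h (suc h) (n<1+n h))

  -- For e ≤ k the endpoint e may be replaced by 0: a walk to 0 with an up-step
  -- ends with at least k descents, the last e of which can be dropped.
  nWalks-up-shift : ∀ {e} → e ≤ k → ∀ h u → nWalks h (suc u) e ≡ nWalks h (suc u) 0
  nWalks-shift : ∀ {e} → e ≤ k → ∀ h u → e ≤ h → nWalks h u e ≡ nWalks h u 0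
  nWalks-up-shift e≤k zero u = nWalks-shift e≤k k u e≤k
  nWalks-up-shift e≤k (suc h) u =
    cong₂ _+_ (nWalks-shift e≤k (suc h + k) u (≤-trans e≤k (m≤n+m k (suc h))))
              (nWalks-up-shift e≤k h u)
  nWalks-shift e≤k h zero e≤h = trans (nWalks-noUp h _ e≤h) (sym (nWalks-noUp h 0 z≤n))
  nWalks-shift e≤k h (suc u) _ = nWalks-up-shift e≤k h u

  MarkedWalks : ℕ → ℕ → Set
  MarkedWalks H u = Σ (Walks H u 0) λ x → Fin (leadingD (proj₁ x))

  markedWalks-suc : ∀ H u → MarkedWalks (suc H) u ↔ (Walks H u 0 ⊎ MarkedWalks H u)
  markedWalks-suc H u = mk↔ₛ′ to from to∘from from∘to
    where
    to : MarkedWalks (suc H) u → Walks H u 0 ⊎ MarkedWalks H u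
    to ((D ∷ p , w , c) , zero) = inj₁ (p , w , c)
    to ((D ∷ p , w , c) , suc i) = inj₂ ((p , w , c) , i)
    from : Walks H u 0 ⊎ MarkedWalks H u → MarkedWalks (suc H) u
    from (inj₁ (p , w , c)) = (D ∷ p , w , c) , zero
    from (inj₂ ((p , w , c) , i)) = (D ∷ p , w , c) , suc i
    to∘from : ∀ y → to (from y) ≡ y
    to∘from (inj₁ _) = refl
    to∘from (inj₂ _) = refl
    from∘to : ∀ x → from (to x) ≡ x
    from∘to ((D ∷ p , w , c) , zero) = refl
    from∘to ((D ∷ p , w , c) , suc i) = refl

  markedWalks-enum : ∀ H u → MarkedWalks H u ↔ Fin (sumBelow H (λ j → nWalks j u 0))
  markedWalks-enum zero u = mk↔ₛ′ empty (λ ()) (λ ()) (λ x → ⊥-elim (¬Fin0 (empty x)))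
    where
    empty : MarkedWalks 0 u → Fin 0
    empty (([] , _ , _) , ())
    empty ((U ∷ p , _ , _) , ())
    empty ((D ∷ p , () , _) , _)
  markedWalks-enum (suc H) u =
    ↔-trans (markedWalks-suc H u) (⊎-Fin (walks-enum H u 0) (markedWalks-enum H u))

  marked↔markedWalks : ∀ m → Marked k (suc m) ↔ MarkedWalks k m
  marked↔markedWalks m = mk↔ₛ′ to from to∘from from∘to
    where
    to : Marked k (suc m) → MarkedWalks k m
    to ((U ∷ p , w , c) , i) = (p , w , suc-injective c) , i
    from : MarkedWalks k m → Marked k (suc m)
    from ((p , w , c) , i) = (U ∷ p , w , cong suc c) , i
    to∘from : ∀ y → to (from y) ≡ y
    to∘from ((p , w , c) , i) = cong (λ c′ → (p , w , c′) , i) (≡-irrelevant _ _)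
    from∘to : ∀ x → from (to x) ≡ x
    from∘to ((U ∷ p , w , c) , i) = cong (λ c′ → (U ∷ p , w , c′) , i) (≡-irrelevant _ _)

  walks-closed-form : ∀ u h →
    nWalks h u 0 + k * binomPred (h + suc k * u) u ≡ binom (h + suc k * u) u
  walks-closed-form zero h = cong₂ _+_ (nWalks-noUp h 0 z≤n) (*-zeroʳ k)
  walks-closed-form (suc v) zero =
    subst (λ X → nWalks k v 0 + k * binom X v ≡ binom X (suc v)) (sym top) from-k
    where
    M : ℕ
    M = k + suc k * v
    top : suc k * suc v ≡ suc M
    top = cong suc (reshape v k)
      where
      reshape : ∀ v k → v + k * suc v ≡ k + suc k * v
      reshape = solve-∀
    from-k : nWalks k v 0 + k * binom (suc M) v ≡ binom (suc M) (suc v)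
    from-k = begin
        nWalks k v 0 + k * binom (suc M) v
      ≡⟨ cong (λ x → nWalks k v 0 + k * x) (pascal M v) ⟩
        nWalks k v 0 + k * (binomPred M v + binom M v)
      ≡⟨ regroup (nWalks k v 0) k (binomPred M v) (binom M v) ⟩
        (nWalks k v 0 + k * binomPred M v) + k * binom M v
      ≡⟨ cong (_+ k * binom M v) (walks-closed-form v k) ⟩
        binom M v + k * binom M v
      ≡⟨ cong (binom M v +_) (sym (binom-at-k k v)) ⟩
        binom M v + binom M (suc v)
      ∎
      where
      regroup : ∀ a k b c → a + k * (b + c) ≡ (a + k * b) + k * c
      regroup = solve-∀
  walks-closed-form (suc v) (suc g) = begin
      (up + down) + k * binom (suc F) v
    ≡⟨ cong (λ z → (up + down) + k * z) (pascal F v) ⟩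
      (up + down) + k * (binomPred F v + binom F v)
    ≡⟨ regroup up down k (binomPred F v) (binom F v) ⟩
      (up + k * binomPred F v) + (down + k * binom F v)
    ≡⟨ cong₂ _+_ up-closed (walks-closed-form (suc v) g) ⟩
      binom F v + binom F (suc v)
    ∎
    where
    F up down : ℕ
    F = g + suc k * suc v
    up = nWalks (suc g + k) v 0
    down = nWalks g (suc v) 0
    reshape : ∀ g v k → g + suc k * suc v ≡ (suc g + k) + suc k * v
    reshape = solve-∀
    regroup : ∀ a b k c d → (a + b) + k * (c + d) ≡ (a + k * c) + (b + k * d)
    regroup = solve-∀
    up-closed : up + k * binomPred F v ≡ binom F v
    up-closed = subst (λ Z → up + k * binomPred Z v ≡ binom Z v)
      (sym (reshape g v k)) (walks-closed-form v (suc g + k))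

  walks-partial-sum : ∀ m T →
    sumBelow T (λ t → nWalks t m 0) + binom (suc k * m) (suc m) + k * binom (T + suc k * m) m
      ≡ binom (T + suc k * m) (suc m) + k * binom (suc k * m) m
  walks-partial-sum m zero = refl
  walks-partial-sum m (suc t) = begin
      (nWalks t m 0 + S) + B + k * binom (suc (t + c)) m
    ≡⟨ cong (λ x → (nWalks t m 0 + S) + B + k * x) (pascal (t + c) m) ⟩
      (nWalks t m 0 + S) + B + k * (binomPred (t + c) m + binom (t + c) m)
    ≡⟨ regroup (nWalks t m 0) S B k (binomPred (t + c) m) (binom (t + c) m) ⟩
      (nWalks t m 0 + k * binomPred (t + c) m) + ((S + B) + k * binom (t + c) m)
    ≡⟨ cong₂ _+_ (walks-closed-form m t) (walks-partial-sum m t) ⟩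
      binom (t + c) m + (binom (t + c) (suc m) + k * binom c m)
    ≡⟨ sym (+-assoc (binom (t + c) m) _ _) ⟩
      (binom (t + c) m + binom (t + c) (suc m)) + k * binom c m
    ∎
    where
    c S B : ℕ
    c = suc k * m
    S = sumBelow t (λ t → nWalks t m 0)
    B = binom c (suc m)
    regroup : ∀ w s b k p q → (w + s) + b + k * (p + q) ≡ (w + k * p) + ((s + b) + k * q)
    regroup = solve-∀

  marked-count : ∀ m → suc m * sumBelow k (λ t → nWalks t m 0) ≡ k * binom (suc k * m) m
  marked-count m = +-cancelʳ-≡ (k * m * B₀) _ _ (begin
      suc m * S + k * m * B₀   ≡⟨ cong (suc m * S +_) (sym (binom-at-0 k m)) ⟩
      suc m * S + suc m * B₁   ≡⟨ sym (*-distribˡ-+ (suc m) S B₁) ⟩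
      suc m * (S + B₁)         ≡⟨ cong (suc m *_) sum+B₁ ⟩
      suc m * (k * B₀)         ≡⟨ regroup m k B₀ ⟩
      k * B₀ + k * m * B₀      ∎)
    where
    c S B₀ B₁ : ℕ
    c = suc k * m
    S = sumBelow k (λ t → nWalks t m 0)
    B₀ = binom c m
    B₁ = binom c (suc m)
    -- the partial sum at T = k, where C(k+c, m+1) = k C(k+c, m) cancels
    sum+B₁ : S + B₁ ≡ k * B₀
    sum+B₁ = +-cancelʳ-≡ (k * binom (k + c) m) _ _
      (trans (walks-partial-sum m k)
        (trans (cong (_+ k * B₀) (binom-at-k k m)) (+-comm (k * binom (k + c) m) (k * B₀))))
    regroup : ∀ m k b → suc m * (k * b) ≡ k * b + k * m * b
    regroup = solve-∀

corollary3p4 : (k n : ℕ) → 1 ≤ k → 1 ≤ n →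
    (Σ ℕ λ N → (Marked k n ↔ Fin N) × (n * N ≡ k * ((suc k * (n ∸ 1)) C (n ∸ 1))))
    × (Marked k n ↔ Elevated k (n ∸ 1))
corollary3p4 k (suc m) _ _ =
  (N , marked-enum , trans (marked-count m) (cong (k *_) (binom≡C (suc k * m) m)))
  , ↔-trans marked-enum (↔-sym elevated-enum)
  where
  open Paths k
  N : ℕ
  N = sumBelow k (λ j → nWalks j m 0)
  marked-enum : Marked k (suc m) ↔ Fin N
  marked-enum = ↔-trans (marked↔markedWalks m) (markedWalks-enum k m)
  elevated-enum : Elevated k m ↔ Fin N
  elevated-enum = subst (λ M → Elevated k m ↔ Fin M)
    (sumBelow-cong k (λ j j<k → nWalks-shift (<⇒≤ j<k) j m ≤-refl))
    (below-Fin k (λ j → walks-enum j m j))
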